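{- Let $\lambda\sim\mu$ be an edge of $G_n$, where $\mu$ is obtained from $\lambda$ by moving one cell from a part of size $x$ to a part of size $y$ (with $y=0$ allowed, meaning a new part of size $1$ is created), and let $S=\operatorname{Supp}(\lambda)$. Write $m_t(\lambda)$ for the multiplicity of the part size $t$ in $\lambda$ and $\Delta_\sigma(\lambda,\mu)=\sigma(\mu)-\sigma(\lambda)$. If $x\neq y$, then \[ \Delta_\sigma(\lambda,\mu)=\mathbf 1_{x>1,\ x-1\notin S}+\mathbf 1_{y+1\notin S}-\mathbf 1_{x=y+2,\ x-1\notin S}-\mathbf 1_{m_x(\lambda)=1}-\mathbf 1_{y>0,\ m_y(\lambda)=1}. \] If $x=y$, then necessarily $m_x(\lambda)\ge 2$, and \[ \Delta_\sigma(\lambda,\mu)=\mathbf 1_{x>1,\ x-1\notin S}+\mathbf 1_{x+1\notin S}-\mathbf 1_{m_x(\lambda)=2}. \]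
   Context: $G_n$ is the partition graph: its vertices are the partitions of $n$, and two distinct partitions $\lambda\neq\mu$ are adjacent when $\mu$ is obtained from $\lambda$ by an elementary transfer: remove one cell from a part of size $x\ge1$ (so that part becomes $x-1$, disappearing if $x=1$) and add it to another part of size $y\ge 1$ or to a new part (the case $y=0$), then reorder the parts in weakly decreasing order. At the multiset level $\mu=(\lambda\setminus\{x,y\})\cup\{x-1,y+1\}$, with parts of size $0$ ignored. The support $\operatorname{Supp}(\lambda)$ is the set of distinct part sizes of $\lambda$ and $\sigma(\lambda)=|\operatorname{Supp}(\lambda)|$. $\mathbf 1_{P}$ denotes the indicator of the condition $P$. -}

module Defs where

import Data.Nat.Properties
open import Data.Nat using (ℕ; _≥_; zero; suc; _≤_; _∸_; _+_; _≟_)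
open import Data.Integer using (ℤ; +_; _-_)
open import Data.List using (List; []; _∷_; length; filter; deduplicate)
open import Data.Nat.ListAction using (sum)
open import Data.List.Relation.Unary.All using (All)
open import Data.List.Relation.Unary.Linked using (Linked)
open import Data.List.Relation.Binary.Permutation.Propositional using (_↭_)
open import Data.List.Membership.Propositional using (_∈_)
open import Data.Product using (_×_; ∃)
open import Relation.Nullary using (Dec; yes; no; ¬_)
open import Relation.Binary.PropositionalEquality using (_≡_; _≢_)

IsPartition : ℕ → List ℕ → Set
IsPartition n λ' = Linked _≥_ λ' × All (1 ≤_) λ' × sum λ' ≡ n

mult : ℕ → List ℕ → ℕ
mult t λ' = length (filter (t ≟_) λ')

σ : List ℕ → ℕ
σ λ' = length (deduplicate _≟_ λ')

dropZeros : List ℕ → List ℕ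
dropZeros = filter (λ k → 1 Data.Nat.≤? k)

-- Elementary transfer of one cell from a part of size x to a part of
-- size y (y = 0 means a new part of size 1), at the multiset level:
-- μ = (λ ∖ {x,y}) ∪ {x-1,y+1}, zero parts ignored.
data Transfer (x y : ℕ) (λ' μ : List ℕ) : Set where
  newPart : y ≡ 0 → 1 ≤ x → (rest : List ℕ) →
            λ' ↭ (x ∷ rest) → μ ↭ dropZeros ((x ∸ 1) ∷ (y + 1) ∷ rest) →
            Transfer x y λ' μ
  oldPart : 1 ≤ y → 1 ≤ x → (rest : List ℕ) →
            λ' ↭ (x ∷ y ∷ rest) → μ ↭ dropZeros ((x ∸ 1) ∷ (y + 1) ∷ rest) →
            Transfer x y λ' μ

IsEdge : ℕ → ℕ → ℕ → List ℕ → List ℕ → Set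
IsEdge n x y λ' μ = IsPartition n λ' × IsPartition n μ × λ' ≢ μ × Transfer x y λ' μ

𝟙 : ∀ {P : Set} → Dec P → ℕ
𝟙 (yes _) = 1
𝟙 (no _) = 0

Δσ : List ℕ → List ℕ → ℤ
Δσ λ' μ = + σ μ - + σ λ'

-- Write λ as x, y and a multiset R of further parts, and μ as x − 1, y + 1 and R, zero parts
-- dropped (which covers y = 0). Adding a part a to a list raises σ by 1_{a ∉ list}, so σ λ and σ μ
-- are σ R plus freshness indicators with respect to R. Each indicator of the statement is one of
-- these in disguise: for x ≠ y, m_x(λ) = 1 + m_x(R), and
--   1_{x>1, x−1 ∉ R} = 1_{x>1, x−1 ∉ {y+1} ∪ R} + 1_{x = y+2, x−1 ∉ R}.
-- A transfer with x = y + 1 does not change the multiset, so it cannot be an edge between two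
-- distinct sorted partitions.
module Submission where

open import Defs
open import Data.Nat using (ℕ; zero; suc; _≤_; _≥_; _∸_; _≟_; _≤?_; _<?_; s≤s; z≤n)
import Data.Nat
import Data.Nat.Properties as ℕ
open import Data.Integer using (+_)
import Data.Integer as ℤ
open import Data.Integer.Properties using (pos-+)
open import Data.Integer.Tactic.RingSolver using (solve-∀)
open import Data.List using (List; _∷_; length)
open import Data.List.Membership.DecPropositional _≟_ using (_∈?_)
open import Data.List.Membership.Propositional using (_∈_; _∉_)
open import Data.List.Membership.Propositional.Properties using (deduplicate-∈⇔)
open import Data.List.Membership.Propositional.Properties.WithK using (unique∧set⇒bag)
open import Data.List.Properties
  using (filter-all; filter-none; filter-some; filter-accept; filter-reject)
open import Data.List.Relation.Unary.All as All using (All)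
open import Data.List.Relation.Unary.All.Properties using (¬Any⇒All¬)
open import Data.List.Relation.Unary.Any using (here; there)
open import Data.List.Relation.Unary.Linked using (Linked)
open import Data.List.Relation.Unary.Unique.DecPropositional.Properties _≟_ using (deduplicate-!)
open import Data.List.Relation.Unary.Sorted.TotalOrder.Properties using (↗↭↗⇒≋)
open import Data.List.Relation.Binary.BagAndSetEquality using (∼bag⇒↭)
open import Data.List.Relation.Binary.Permutation.Propositional
  using (_↭_; ↭-refl; ↭-trans; ↭-sym; ↭⇒↭ₛ; swap)
open import Data.List.Relation.Binary.Permutation.Propositional.Properties
  using (↭-length; filter-↭; All-resp-↭; ∈-resp-↭)
open import Data.List.Relation.Binary.Pointwise using (Pointwise-≡⇒≡)
open import Data.Product using (_×_; _,_; proj₂; ∃-syntax)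
open import Function using (_∘_; id)
open import Function.Bundles using (_⇔_; mk⇔; Equivalence)
open import Function.Construct.Composition using (_⇔-∘_)
open import Function.Construct.Symmetry using (⇔-sym)
open import Relation.Binary.Construct.Flip.EqAndOrd using (totalOrder)
open import Relation.Binary.PropositionalEquality
  using (_≡_; _≢_; ≢-sym; refl; sym; trans; cong; cong₂; subst)
open import Relation.Nullary using (Dec; yes; no; ¬_; contradiction)
open import Relation.Nullary.Decidable using (_×-dec_; ¬?)

-- ℕ addition is opened only inside this module: the statement uses ℤ's _+_ unqualified.
module _ where
  open import Data.Nat using (_+_)

  𝟙-cong : ∀ {P Q : Set} (p : Dec P) (q : Dec Q) → (P → Q) → (Q → P) → 𝟙 p ≡ 𝟙 q
  𝟙-cong (yes _) (yes _) _ _ = refl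
  𝟙-cong (yes p) (no ¬q) f _ = contradiction (f p) ¬q
  𝟙-cong (no ¬p) (yes q) _ g = contradiction (g q) ¬p
  𝟙-cong (no _)  (no _)  _ _ = refl

  𝟙-no : ∀ {P : Set} (p : Dec P) → ¬ P → 𝟙 p ≡ 0
  𝟙-no (yes p) ¬p = contradiction p ¬p
  𝟙-no (no _)  _  = refl

  𝟙∉ : ℕ → List ℕ → ℕ
  𝟙∉ a l = 𝟙 (¬? (a ∈? l))

  σ-cong : ∀ {l m} → (∀ {a} → a ∈ l ⇔ a ∈ m) → σ l ≡ σ m
  σ-cong {l} {m} l≈m = ↭-length (∼bag⇒↭ (unique∧set⇒bag (deduplicate-! l) (deduplicate-! m)
    (deduplicate-∈⇔ _≟_ ⇔-∘ (l≈m ⇔-∘ ⇔-sym (deduplicate-∈⇔ _≟_)))))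

  σ-resp-↭ : ∀ {l m} → l ↭ m → σ l ≡ σ m
  σ-resp-↭ l↭m = σ-cong (mk⇔ (∈-resp-↭ l↭m) (∈-resp-↭ (↭-sym l↭m)))

  σ-∷ : ∀ a l → σ (a ∷ l) ≡ 𝟙∉ a l + σ l
  σ-∷ a l with a ∈? l
  ... | yes a∈l = σ-cong (mk⇔ (λ { (here refl) → a∈l ; (there a′∈l) → a′∈l }) there)
  ... | no a∉l = cong (suc ∘ length) (filter-all (¬? ∘ (a ≟_))
    (¬Any⇒All¬ _ (a∉l ∘ Equivalence.from (deduplicate-∈⇔ _≟_))))

  σ-dropZeros-∷ : ∀ a l →
    σ (dropZeros (a ∷ l)) ≡ 𝟙 ((1 ≤? a) ×-dec ¬? (a ∈? dropZeros l)) + σ (dropZeros l)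
  σ-dropZeros-∷ zero    l = refl
  σ-dropZeros-∷ (suc a) l = trans (σ-∷ (suc a) (dropZeros l))
    (cong (_+ σ (dropZeros l))
      (𝟙-cong (¬? (suc a ∈? dropZeros l)) ((1 ≤? suc a) ×-dec ¬? (suc a ∈? dropZeros l))
        (s≤s z≤n ,_) proj₂))

  mult-resp-↭ : ∀ {a l m} → l ↭ m → mult a l ≡ mult a m
  mult-resp-↭ {a} l↭m = ↭-length (filter-↭ (a ≟_) l↭m)

  mult-∷-≡ : ∀ a l → mult a (a ∷ l) ≡ suc (mult a l)
  mult-∷-≡ a l = cong length (filter-accept (a ≟_) refl)

  mult-∷-≢ : ∀ {a b} l → a ≢ b → mult a (b ∷ l) ≡ mult a l
  mult-∷-≢ {a} l a≢b = cong length (filter-reject (a ≟_) a≢b)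

  mult-dropZeros-∷-≡ : ∀ {a} l → 1 ≤ a → mult a (dropZeros (a ∷ l)) ≡ suc (mult a (dropZeros l))
  mult-dropZeros-∷-≡ l (s≤s z≤n) = mult-∷-≡ _ (dropZeros l)

  mult-dropZeros-∷-≢ : ∀ {a} b l → a ≢ b → mult a (dropZeros (b ∷ l)) ≡ mult a (dropZeros l)
  mult-dropZeros-∷-≢ zero    l _   = refl
  mult-dropZeros-∷-≢ (suc b) l a≢b = mult-∷-≢ (dropZeros l) a≢b

  mult-↭-∷-∷ : ∀ {a l m} → l ↭ a ∷ a ∷ m → mult a l ≡ 2 + mult a m
  mult-↭-∷-∷ {a} {m = m} l↭ =
    trans (mult-resp-↭ l↭) (trans (mult-∷-≡ a (a ∷ m)) (cong suc (mult-∷-≡ a m)))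

  ↭-∷-∷⇒2≤mult : ∀ {a l m} → l ↭ a ∷ a ∷ m → 2 ≤ mult a l
  ↭-∷-∷⇒2≤mult l↭ = subst (2 ≤_) (sym (mult-↭-∷-∷ l↭)) (ℕ.m≤m+n 2 _)

  ∉⇒mult≡0 : ∀ {a l} → a ∉ l → mult a l ≡ 0
  ∉⇒mult≡0 {a} {l} a∉l = cong length (filter-none (a ≟_) (¬Any⇒All¬ l a∉l))

  mult≡0⇒∉ : ∀ {a l} → mult a l ≡ 0 → a ∉ l
  mult≡0⇒∉ {a} mult≡0 a∈l = ℕ.m<n⇒n≢0 (filter-some (a ≟_) a∈l) mult≡0

  ∉-resp-mult : ∀ {a l m} → mult a l ≡ mult a m → a ∉ l → a ∉ m
  ∉-resp-mult eq a∉l = mult≡0⇒∉ (trans (sym eq) (∉⇒mult≡0 a∉l))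

  𝟙∉-resp-mult : ∀ {a l m} → mult a l ≡ mult a m → 𝟙∉ a l ≡ 𝟙∉ a m
  𝟙∉-resp-mult eq = 𝟙-cong _ _ (∉-resp-mult eq) (∉-resp-mult (sym eq))

  𝟙-×∉-resp-mult : ∀ {P Q : Set} {a l m} (p : Dec P) (q : Dec Q) → (P → Q) → (Q → P) →
    mult a l ≡ mult a m → 𝟙 (p ×-dec ¬? (a ∈? l)) ≡ 𝟙 (q ×-dec ¬? (a ∈? m))
  𝟙-×∉-resp-mult p q P⇒Q Q⇒P eq = 𝟙-cong _ _
    (λ (pa , a∉l) → P⇒Q pa , ∉-resp-mult eq a∉l)
    (λ (qa , a∉m) → Q⇒P qa , ∉-resp-mult (sym eq) a∉m)

  mult≡j⇔∉ : ∀ {a l m} j → mult a l ≡ j + mult a m → (mult a l ≡ j ⇔ a ∉ m)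
  mult≡j⇔∉ j eq = mk⇔
    (λ mult≡j → mult≡0⇒∉
      (ℕ.+-cancelˡ-≡ j _ _ (trans (sym eq) (trans mult≡j (sym (ℕ.+-identityʳ j))))))
    (λ a∉m → trans eq (trans (cong (λ n → j + n) (∉⇒mult≡0 a∉m)) (ℕ.+-identityʳ j)))

  𝟙[mult≟j]≡𝟙∉ : ∀ {a l m} j → mult a l ≡ j + mult a m → 𝟙 (mult a l ≟ j) ≡ 𝟙∉ a m
  𝟙[mult≟j]≡𝟙∉ {a} {l} {m} j eq = 𝟙-cong _ _ to from
    where open Equivalence (mult≡j⇔∉ {a} {l} {m} j eq)

  dropZeros-all : ∀ {l} → All (1 ≤_) l → dropZeros l ≡ l
  dropZeros-all = filter-all (1 ≤?_)

  dropZeros-∷-swap : ∀ {b} a l → 1 ≤ b → b ∷ dropZeros (a ∷ l) ↭ dropZeros (a ∷ b ∷ l)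
  dropZeros-∷-swap zero    l (s≤s z≤n) = ↭-refl
  dropZeros-∷-swap (suc a) l (s≤s z≤n) = swap _ _ ↭-refl

  ↭-sorted⇒≡ : ∀ {xs ys : List ℕ} → Linked _≥_ xs → Linked _≥_ ys → xs ↭ ys → xs ≡ ys
  ↭-sorted⇒≡ xs↘ ys↘ xs↭ys = Pointwise-≡⇒≡ (↗↭↗⇒≋ (totalOrder ℕ.≤-totalOrder) xs↘ ys↘ (↭⇒↭ₛ xs↭ys))

  transfer-source-pos : ∀ {x y λ' μ} → Transfer x y λ' μ → 1 ≤ x
  transfer-source-pos (newPart _ 1≤x _ _ _) = 1≤x
  transfer-source-pos (oldPart _ 1≤x _ _ _) = 1≤x

  transfer-shape : ∀ {x y λ' μ} → All (1 ≤_) λ' → Transfer x y λ' μ →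
    ∃[ rest ] λ' ↭ x ∷ dropZeros (y ∷ rest) × μ ↭ dropZeros (x ∸ 1 ∷ y + 1 ∷ rest)
  transfer-shape λ⁺ (newPart refl _ rest λ↭ μ↭) =
    rest , subst (λ l → _ ↭ _ ∷ l) (sym (dropZeros-all (All.tail (All-resp-↭ λ↭ λ⁺)))) λ↭ , μ↭
  transfer-shape λ⁺ (oldPart _ _ rest λ↭ μ↭) =
    rest , subst (λ l → _ ↭ _ ∷ l) (sym (dropZeros-all (All.tail (All-resp-↭ λ↭ λ⁺)))) λ↭ , μ↭

  transfer-from-suc-is-↭ : ∀ {y rest λ' μ} →
    λ' ↭ suc y ∷ dropZeros (y ∷ rest) → μ ↭ dropZeros (y ∷ y + 1 ∷ rest) → λ' ↭ μ
  transfer-from-suc-is-↭ {y} {rest} λ↭ μ↭ = ↭-trans λ↭ (↭-trans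
    (subst (λ b → suc y ∷ dropZeros (y ∷ rest) ↭ dropZeros (y ∷ b ∷ rest)) (ℕ.+-comm 1 y)
      (dropZeros-∷-swap y rest (s≤s z≤n)))
    (↭-sym μ↭))

  edge⇒pred-x≢y : ∀ {k y rest λ' μ} → Linked _≥_ λ' → Linked _≥_ μ → λ' ≢ μ →
    λ' ↭ suc k ∷ dropZeros (y ∷ rest) → μ ↭ dropZeros (k ∷ y + 1 ∷ rest) → k ≢ y
  edge⇒pred-x≢y λ↘ μ↘ λ≢μ λ↭ μ↭ refl = λ≢μ (↭-sorted⇒≡ λ↘ μ↘ (transfer-from-suc-is-↭ λ↭ μ↭))

  σ-target : ∀ {μ} k b rest → μ ↭ dropZeros (k ∷ b ∷ rest) → 1 ≤ b →
    σ μ ≡ 𝟙 ((1 ≤? k) ×-dec ¬? (k ∈? b ∷ dropZeros rest))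
          + (𝟙∉ b (dropZeros rest) + σ (dropZeros rest))
  σ-target k b rest μ↭ (s≤s z≤n) =
    trans (σ-resp-↭ μ↭) (trans (σ-dropZeros-∷ k (b ∷ rest))
      (cong₂ _+_ refl (σ-∷ b (dropZeros rest))))

  -- Here and below k = x − 1; the second summand is the correction term 1_{x = y+2, x−1 ∉ S}.
  𝟙-∉-∷-split : ∀ k y r →
    𝟙 ((1 ≤? k) ×-dec ¬? (k ∈? y + 1 ∷ r)) + 𝟙 ((suc k ≟ y + 2) ×-dec ¬? (k ∈? r))
      ≡ 𝟙 ((1 ≤? k) ×-dec ¬? (k ∈? r))
  -- Not k ≟ y + 1: that test occurs inside k ∈? y + 1 ∷ r and would be abstracted too.
  𝟙-∉-∷-split k y r with y + 1 ≟ k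
  ... | yes refl = trans
    (cong (_+ 𝟙 ((suc k ≟ y + 2) ×-dec ¬? (k ∈? r)))
      (𝟙-no ((1 ≤? k) ×-dec ¬? (k ∈? k ∷ r)) (λ (_ , k∉) → k∉ (here refl))))
    (𝟙-cong ((suc k ≟ y + 2) ×-dec ¬? (k ∈? r)) ((1 ≤? k) ×-dec ¬? (k ∈? r))
      (λ (_ , k∉r) → ℕ.m≤n+m 1 y , k∉r) (λ (_ , k∉r) → sym (ℕ.+-suc y 1) , k∉r))
  ... | no y+1≢k = trans (cong₂ _+_
      (𝟙-cong ((1 ≤? k) ×-dec ¬? (k ∈? y + 1 ∷ r)) ((1 ≤? k) ×-dec ¬? (k ∈? r))
        (λ (1≤k , k∉) → 1≤k , k∉ ∘ there)
        (λ (1≤k , k∉r) → 1≤k , λ { (here k≡y+1) → y+1≢k (sym k≡y+1) ; (there k∈r) → k∉r k∈r }))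
      (𝟙-no ((suc k ≟ y + 2) ×-dec ¬? (k ∈? r))
        (λ (x≡y+2 , _) → y+1≢k (sym (ℕ.suc-injective (trans x≡y+2 (ℕ.+-suc y 1)))))))
    (ℕ.+-identityʳ _)

  distinct-bookkeeping : ∀ {σμ σλ t₁ t₂ t₃ t₄ t₅ n b c d e s} →
    σμ ≡ n + (b + s) → σλ ≡ c + (d + s) →
    t₁ ≡ n + e → t₂ ≡ b → t₃ ≡ e → t₄ ≡ c → t₅ ≡ d →
    + σμ ℤ.- + σλ ≡ + t₁ ℤ.+ + t₂ ℤ.- + t₃ ℤ.- + t₄ ℤ.- + t₅
  distinct-bookkeeping {n = n} {b} {c} {d} {e} {s} refl refl refl refl refl refl refl
    rewrite pos-+ n (b + s) | pos-+ b s | pos-+ c (d + s) | pos-+ d s | pos-+ n e =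
    regroup (+ n) (+ b) (+ c) (+ d) (+ e) (+ s)
    where
    regroup : ∀ N B C D E S →
      N ℤ.+ (B ℤ.+ S) ℤ.- (C ℤ.+ (D ℤ.+ S)) ≡ N ℤ.+ E ℤ.+ B ℤ.- E ℤ.- C ℤ.- D
    regroup = solve-∀

  equal-bookkeeping : ∀ {σμ σλ t₁ t₂ t₃ n b c s} →
    σμ ≡ n + (b + s) → σλ ≡ c + s → t₁ ≡ n → t₂ ≡ b → t₃ ≡ c →
    + σμ ℤ.- + σλ ≡ + t₁ ℤ.+ + t₂ ℤ.- + t₃
  equal-bookkeeping {n = n} {b} {c} {s} refl refl refl refl refl
    rewrite pos-+ n (b + s) | pos-+ b s | pos-+ c s =
    regroup (+ n) (+ b) (+ c) (+ s)
    where
    regroup : ∀ N B C S → N ℤ.+ (B ℤ.+ S) ℤ.- (C ℤ.+ S) ≡ N ℤ.+ B ℤ.- C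
    regroup = solve-∀

  Δσ-distinct : ∀ {k y rest λ' μ} →
    λ' ↭ suc k ∷ dropZeros (y ∷ rest) → μ ↭ dropZeros (k ∷ y + 1 ∷ rest) → suc k ≢ y → k ≢ y →
    Δσ λ' μ ≡ + 𝟙 ((1 <? suc k) ×-dec ¬? (k ∈? λ')) ℤ.+ + 𝟙∉ (y + 1) λ'
              ℤ.- + 𝟙 ((suc k ≟ y + 2) ×-dec ¬? (k ∈? λ')) ℤ.- + 𝟙 (mult (suc k) λ' ≟ 1)
              ℤ.- + 𝟙 ((0 <? y) ×-dec (mult y λ' ≟ 1))
  Δσ-distinct {k} {y} {rest} {λ'} λ↭ μ↭ x≢y k≢y =
    distinct-bookkeeping (σ-target k (y + 1) rest μ↭ (ℕ.m≤n+m 1 y)) σλ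
      (trans T₁ (sym (𝟙-∉-∷-split k y r))) T₂ T₃ T₄ T₅
    where
    r = dropZeros rest
    k≢x : k ≢ suc k
    k≢x = ℕ.<⇒≢ (ℕ.n<1+n k)
    mult-other : ∀ {a} → a ≢ suc k → a ≢ y → mult a λ' ≡ mult a r
    mult-other a≢x a≢y =
      trans (mult-resp-↭ λ↭) (trans (mult-∷-≢ _ a≢x) (mult-dropZeros-∷-≢ y rest a≢y))
    mult-x : mult (suc k) λ' ≡ 1 + mult (suc k) r
    mult-x =
      trans (mult-resp-↭ λ↭) (trans (mult-∷-≡ (suc k) _) (cong suc (mult-dropZeros-∷-≢ y rest x≢y)))
    mult-y : 1 ≤ y → mult y λ' ≡ 1 + mult y r
    mult-y 1≤y =
      trans (mult-resp-↭ λ↭) (trans (mult-∷-≢ _ (≢-sym x≢y)) (mult-dropZeros-∷-≡ rest 1≤y))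
    σλ : σ λ' ≡ 𝟙∉ (suc k) r + (𝟙 ((1 ≤? y) ×-dec ¬? (y ∈? r)) + σ r)
    σλ = trans (σ-resp-↭ λ↭) (trans (σ-∷ (suc k) (dropZeros (y ∷ rest)))
           (cong₂ _+_ (𝟙∉-resp-mult {m = r} (mult-dropZeros-∷-≢ y rest x≢y))
                      (σ-dropZeros-∷ y rest)))
    T₁ : 𝟙 ((1 <? suc k) ×-dec ¬? (k ∈? λ')) ≡ 𝟙 ((1 ≤? k) ×-dec ¬? (k ∈? r))
    T₁ = 𝟙-×∉-resp-mult (1 <? suc k) (1 ≤? k) ℕ.≤-pred s≤s (mult-other k≢x k≢y)
    T₂ : 𝟙∉ (y + 1) λ' ≡ 𝟙∉ (y + 1) r
    T₂ = 𝟙∉-resp-mult (mult-other y+1≢x (ℕ.m+1+n≢m y))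
      where
      y+1≢x : y + 1 ≢ suc k
      y+1≢x y+1≡x = k≢y (ℕ.suc-injective (trans (sym y+1≡x) (ℕ.+-comm y 1)))
    T₃ : 𝟙 ((suc k ≟ y + 2) ×-dec ¬? (k ∈? λ')) ≡ 𝟙 ((suc k ≟ y + 2) ×-dec ¬? (k ∈? r))
    T₃ = 𝟙-×∉-resp-mult (suc k ≟ y + 2) (suc k ≟ y + 2) id id (mult-other k≢x k≢y)
    T₄ : 𝟙 (mult (suc k) λ' ≟ 1) ≡ 𝟙∉ (suc k) r
    T₄ = 𝟙[mult≟j]≡𝟙∉ {l = λ'} {m = r} 1 mult-x
    T₅ : 𝟙 ((0 <? y) ×-dec (mult y λ' ≟ 1)) ≡ 𝟙 ((1 ≤? y) ×-dec ¬? (y ∈? r))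
    T₅ = 𝟙-cong ((0 <? y) ×-dec (mult y λ' ≟ 1)) ((1 ≤? y) ×-dec ¬? (y ∈? r))
           (λ (1≤y , e) → 1≤y , Equivalence.to (mult≡j⇔∉ {l = λ'} {m = r} 1 (mult-y 1≤y)) e)
           (λ (1≤y , y∉r) → 1≤y , Equivalence.from (mult≡j⇔∉ {l = λ'} {m = r} 1 (mult-y 1≤y)) y∉r)

  Δσ-equal : ∀ {k rest λ' μ} →
    λ' ↭ suc k ∷ suc k ∷ dropZeros rest → μ ↭ dropZeros (k ∷ suc k + 1 ∷ rest) →
    Δσ λ' μ ≡ + 𝟙 ((1 <? suc k) ×-dec ¬? (k ∈? λ')) ℤ.+ + 𝟙∉ (suc k + 1) λ'
              ℤ.- + 𝟙 (mult (suc k) λ' ≟ 2)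
  Δσ-equal {k} {rest} {λ'} λ↭ μ↭ =
    equal-bookkeeping (σ-target k (suc k + 1) rest μ↭ (ℕ.m≤n+m 1 (suc k))) σλ T₁ T₂ T₃
    where
    r = dropZeros rest
    k≢x : k ≢ suc k
    k≢x = ℕ.<⇒≢ (ℕ.n<1+n k)
    x+1≢x : suc k + 1 ≢ suc k
    x+1≢x = ℕ.m+1+n≢m (suc k)
    σλ : σ λ' ≡ 𝟙∉ (suc k) r + σ r
    σλ = trans (σ-resp-↭ λ↭) (trans (σ-∷ (suc k) (suc k ∷ r))
           (cong₂ _+_ (𝟙-no (¬? (suc k ∈? suc k ∷ r)) (λ x∉ → x∉ (here refl))) (σ-∷ (suc k) r)))
    T₁ : 𝟙 ((1 <? suc k) ×-dec ¬? (k ∈? λ')) ≡ 𝟙 ((1 ≤? k) ×-dec ¬? (k ∈? suc k + 1 ∷ r))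
    T₁ = 𝟙-×∉-resp-mult (1 <? suc k) (1 ≤? k) ℕ.≤-pred s≤s
           (trans (mult-resp-↭ λ↭) (trans (mult-∷-≢ (suc k ∷ r) k≢x)
             (trans (mult-∷-≢ r k≢x) (sym (mult-∷-≢ r (ℕ.<⇒≢ (ℕ.m≤m+n (suc k) 1)))))))
    T₂ : 𝟙∉ (suc k + 1) λ' ≡ 𝟙∉ (suc k + 1) r
    T₂ = 𝟙∉-resp-mult {m = r}
           (trans (mult-resp-↭ λ↭) (trans (mult-∷-≢ (suc k ∷ r) x+1≢x) (mult-∷-≢ r x+1≢x)))
    T₃ : 𝟙 (mult (suc k) λ' ≟ 2) ≡ 𝟙∉ (suc k) r
    T₃ = 𝟙[mult≟j]≡𝟙∉ {l = λ'} {m = r} 2 (mult-↭-∷-∷ λ↭)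

open import Data.Integer using (_+_; _-_)

theorem3p4 : (n x y : ℕ) (λ' μ : List ℕ) → IsEdge n x y λ' μ →
    (x ≢ y →
      Δσ λ' μ ≡
        + 𝟙 ((1 Data.Nat.<? x) ×-dec ¬? ((x ∸ 1) ∈? λ'))
        + + 𝟙 (¬? ((y Data.Nat.+ 1) ∈? λ'))
        - + 𝟙 ((x ≟ y Data.Nat.+ 2) ×-dec ¬? ((x ∸ 1) ∈? λ'))
        - + 𝟙 (mult x λ' ≟ 1)
        - + 𝟙 ((0 Data.Nat.<? y) ×-dec (mult y λ' ≟ 1)))
    × (x ≡ y →
      (2 ≤ mult x λ')
      × (Δσ λ' μ ≡
        + 𝟙 ((1 Data.Nat.<? x) ×-dec ¬? ((x ∸ 1) ∈? λ'))
        + + 𝟙 (¬? ((x Data.Nat.+ 1) ∈? λ'))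
        - + 𝟙 (mult x λ' ≟ 2)))
theorem3p4 n x y λ' μ ((λ↘ , λ⁺ , _) , (μ↘ , _ , _) , λ≢μ , transfer)
  with transfer-shape λ⁺ transfer | transfer-source-pos transfer
... | rest , λ↭ , μ↭ | s≤s {n = k} z≤n =
  (λ x≢y → Δσ-distinct λ↭ μ↭ x≢y (edge⇒pred-x≢y λ↘ μ↘ λ≢μ λ↭ μ↭)) ,
  (λ { refl → ↭-∷-∷⇒2≤mult λ↭ , Δσ-equal λ↭ μ↭ })
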